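{- Let $n\ge1$ and $i,j\in\{ -(n+1),\dots,n+1\}$, with $R_i$ as in the context. Then $R_i\circ R_j=R_i$ if $|j|<|i|$; $R_i\circ R_j=R_j$ if $|i|<|j|$; and $R_i\circ R_j=R_{\min\{i,j\}}$ if $|i|=|j|$.
   Context: Fix $n\ge1$. For $p=(p_1,\dots,p_n)\in\mathbb Q^n$: $(p,q)\in L_1$ iff $p_1<q_1$; for $2\le i\le n$, $(p,q)\in L_i$ iff $(p_1,\dots,p_{i-1})=(q_1,\dots,q_{i-1})$ and $p_i<q_i$. Let $<_n=L_1\cup\dots\cup L_n$. Let $X=\mathbb Q^n\times\{ -1,1\}$, writing $p^b$ for $(p,b)$, with $p^b\le_X q^d$ iff $p^b=q^d$ or $p<_nq$. Let $\alpha(p^b)=p^{ -b}$. For $R\subseteq X^2$, $R^c=X^2\setminus R$, $R^\smile$ is the converse, $\circ$ is relational composition. $U_j=\{(p^b,q^d)\mid b,d\in\{ -1,1\},(p,q)\in L_j\}$ for $1\le j\le n$. $R_{ -n-1}=\varnothing$; $R_i=\bigcup_{j=1}^{n+1+i}U_j$ for $-n\le i\le-1$; $R_0={\le_X}$; $R_i=(R_{ -i})^{c\smile}\circ\alpha$ for $1\le i\le n+1$. -}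

module Defs where

open import Data.Nat as ℕ using (ℕ; zero; suc; _∸_)
open import Data.Integer as ℤ using (ℤ; +_; -[1+_])
open import Data.Rational as ℚ using (ℚ)
open import Data.Fin using (Fin; toℕ)
open import Data.Vec using (Vec; lookup)
open import Data.Product using (Σ; ∃; _×_; _,_)
open import Data.Sum using (_⊎_)
open import Data.Empty using (⊥)
open import Relation.Nullary using (¬_)
open import Relation.Binary.PropositionalEquality using (_≡_)

Pt : ℕ → Set
Pt n = Vec ℚ n

-- L_{j+1} for j : Fin n (0-based index j stands for the paper's index j+1)
L : {n : ℕ} → Fin n → Pt n → Pt n → Set
L j p q = (∀ k → toℕ k ℕ.< toℕ j → lookup p k ≡ lookup q k) × (lookup p j ℚ.< lookup q j)

_<ₙ_ : {n : ℕ} → Pt n → Pt n → Set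
p <ₙ q = ∃ λ j → L j p q

data Sign : Set where
  neg pos : Sign

flipSign : Sign → Sign
flipSign neg = pos
flipSign pos = neg

X : ℕ → Set
X n = Pt n × Sign

Relₓ : ℕ → Set₁
Relₓ n = X n → X n → Set

_ᶜ : {n : ℕ} → Relₓ n → Relₓ n
(R ᶜ) x y = ¬ R x y

_˘ : {n : ℕ} → Relₓ n → Relₓ n
(R ˘) x y = R y x

_∘ᵣ_ : {n : ℕ} → Relₓ n → Relₓ n → Relₓ n
(R ∘ᵣ S) x z = ∃ λ y → R x y × S y z

_≐_ : {n : ℕ} → Relₓ n → Relₓ n → Set
R ≐ S = (∀ x y → R x y → S x y) × (∀ x y → S x y → R x y)

α : (n : ℕ) → X n → X n
α n (p , b) = (p , flipSign b)

αRel : (n : ℕ) → Relₓ n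
αRel n x y = y ≡ α n x

_≤ₓ_ : {n : ℕ} → X n → X n → Set
(p , b) ≤ₓ (q , d) = ((p , b) ≡ (q , d)) ⊎ (p <ₙ q)

U : {n : ℕ} → Fin n → Relₓ n
U j (p , b) (q , d) = L j p q

-- R_{-(k+1)} = ⋃_{j=1}^{n+1-(k+1)} U_j = ⋃_{j=1}^{n-k} U_j
-- (for k = n this is the empty union, i.e. R_{-n-1} = ∅)
Rneg : (n : ℕ) → ℕ → Relₓ n
Rneg n k x y = ∃ λ (j : Fin n) → (toℕ j ℕ.< n ∸ k) × U j x y

-- R_i for i : ℤ (meaningful for -(n+1) ≤ i ≤ n+1)
R : (n : ℕ) → ℤ → Relₓ n
R n (+ zero) = _≤ₓ_
R n (+ suc k) = (((Rneg n k) ᶜ) ˘) ∘ᵣ αRel n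
R n -[1+ k ] = Rneg n k

-- For i ≠ 0 the relation R_i only looks at a prefix of the coordinates: R_{-k-1} is the strict
-- lexicographic order on the first n - k coordinates and R_{k+1} the corresponding weak order,
-- while R_0 is finer than all of them. Composing with a finer relation that is contained in the
-- weak order of the coarser level changes nothing, because one can always step along the finer
-- relation while staying equivalent at the coarser level. At equal levels the claims are
-- transitivity and reflexivity, except for R_{-k-1} ∘ R_{-k-1}, which is density of ℚ.
module Submission where

open import Defs
open import Data.Nat using (ℕ; zero; suc; pred; _∸_; _≤_; _<_; z≤n; s≤s; z<s; s<s)
import Data.Nat.Properties as ℕP
open import Data.Integer using (ℤ; +_; -[1+_]; ∣_∣; _⊓_)
open import Data.Rational as ℚ using (ℚ; 1ℚ; -_)
import Data.Rational.Properties as ℚP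
open import Data.Fin using (Fin; toℕ) renaming (zero to fzero; suc to fsuc)
open import Data.Fin.Properties using (toℕ<n)
open import Data.Vec using (Vec; []; _∷_; lookup)
open import Data.Product using (∃; _×_; _,_; proj₁; proj₂)
open import Data.Sum using (_⊎_; inj₁; inj₂)
open import Relation.Nullary using (¬_; contradiction)
open import Relation.Binary using (tri<; tri≈; tri>)
open import Relation.Binary.PropositionalEquality using (_≡_; refl; cong; subst)
open import Function using (_∘_)

private variable
  n d e k : ℕ
  a b : ℚ
  p q r : Vec ℚ n

x-1<x : ∀ x → x ℚ.- 1ℚ ℚ.< x
x-1<x x = subst (x ℚ.- 1ℚ ℚ.<_) (ℚP.+-identityʳ x) (ℚP.+-monoʳ-< x (ℚP.negative⁻¹ (- 1ℚ)))

x<x+1 : ∀ x → x ℚ.< x ℚ.+ 1ℚ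
x<x+1 x = subst (ℚ._< x ℚ.+ 1ℚ) (ℚP.+-identityʳ x) (ℚP.+-monoʳ-< x (ℚP.positive⁻¹ 1ℚ))

infix 4 _≋[_]_ _≺[_]_ _≼[_]_

-- Agreement and lexicographic comparison on the first d coordinates; p ≺[ d ] q is the
-- paper's (p , q) ∈ L_1 ∪ … ∪ L_d.
data _≋[_]_ : Vec ℚ n → ℕ → Vec ℚ n → Set where
  ≋-zero : p ≋[ zero ] q
  ≋-[]   : [] ≋[ suc d ] []
  ≋-∷    : p ≋[ d ] q → a ∷ p ≋[ suc d ] a ∷ q

data _≺[_]_ : Vec ℚ n → ℕ → Vec ℚ n → Set where
  ≺-here  : a ℚ.< b → a ∷ p ≺[ suc d ] b ∷ q
  ≺-there : p ≺[ d ] q → a ∷ p ≺[ suc d ] a ∷ q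

_≼[_]_ : Vec ℚ n → ℕ → Vec ℚ n → Set
p ≼[ d ] q = p ≺[ d ] q ⊎ p ≋[ d ] q

≋-refl : ∀ d (p : Vec ℚ n) → p ≋[ d ] p
≋-refl zero    p       = ≋-zero
≋-refl (suc d) []      = ≋-[]
≋-refl (suc d) (a ∷ p) = ≋-∷ (≋-refl d p)

≋-trans : p ≋[ d ] q → q ≋[ d ] r → p ≋[ d ] r
≋-trans ≋-zero      _           = ≋-zero
≋-trans ≋-[]        ≋-[]        = ≋-[]
≋-trans (≋-∷ p≋q) (≋-∷ q≋r) = ≋-∷ (≋-trans p≋q q≋r)

≺-trans : p ≺[ d ] q → q ≺[ d ] r → p ≺[ d ] r
≺-trans (≺-here a<b)  (≺-here b<c)  = ≺-here (ℚP.<-trans a<b b<c)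
≺-trans (≺-here a<b)  (≺-there _)   = ≺-here a<b
≺-trans (≺-there _)   (≺-here b<c)  = ≺-here b<c
≺-trans (≺-there p≺q) (≺-there q≺r) = ≺-there (≺-trans p≺q q≺r)

≺-≋-trans : p ≺[ d ] q → q ≋[ d ] r → p ≺[ d ] r
≺-≋-trans (≺-here a<b)  (≋-∷ _)   = ≺-here a<b
≺-≋-trans (≺-there p≺q) (≋-∷ q≋r) = ≺-there (≺-≋-trans p≺q q≋r)

≋-≺-trans : p ≋[ d ] q → q ≺[ d ] r → p ≺[ d ] r
≋-≺-trans (≋-∷ _)   (≺-here b<c)  = ≺-here b<c
≋-≺-trans (≋-∷ p≋q) (≺-there q≺r) = ≺-there (≋-≺-trans p≋q q≺r)

≺-irrefl : ¬ p ≺[ d ] p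
≺-irrefl (≺-here a<a)  = ℚP.<-irrefl refl a<a
≺-irrefl (≺-there p≺p) = ≺-irrefl p≺p

≺-compare : ∀ d (p q : Vec ℚ n) → p ≺[ d ] q ⊎ p ≋[ d ] q ⊎ q ≺[ d ] p
≺-compare zero    p       q       = inj₂ (inj₁ ≋-zero)
≺-compare (suc d) []      []      = inj₂ (inj₁ ≋-[])
≺-compare (suc d) (a ∷ p) (b ∷ q) with ℚP.<-cmp a b
... | tri< a<b _ _ = inj₁ (≺-here a<b)
... | tri> _ _ b<a = inj₂ (inj₂ (≺-here b<a))
... | tri≈ _ refl _ with ≺-compare d p q
...   | inj₁ p≺q          = inj₁ (≺-there p≺q)
...   | inj₂ (inj₁ p≋q)   = inj₂ (inj₁ (≋-∷ p≋q))
...   | inj₂ (inj₂ q≺p)   = inj₂ (inj₂ (≺-there q≺p))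

≼-trans : p ≼[ d ] q → q ≼[ d ] r → p ≼[ d ] r
≼-trans (inj₁ p≺q) (inj₁ q≺r) = inj₁ (≺-trans p≺q q≺r)
≼-trans (inj₁ p≺q) (inj₂ q≋r) = inj₁ (≺-≋-trans p≺q q≋r)
≼-trans (inj₂ p≋q) (inj₁ q≺r) = inj₁ (≋-≺-trans p≋q q≺r)
≼-trans (inj₂ p≋q) (inj₂ q≋r) = inj₂ (≋-trans p≋q q≋r)

≺-≼-trans : p ≺[ d ] q → q ≼[ d ] r → p ≺[ d ] r
≺-≼-trans p≺q (inj₁ q≺r) = ≺-trans p≺q q≺r
≺-≼-trans p≺q (inj₂ q≋r) = ≺-≋-trans p≺q q≋r

≼-≺-trans : p ≼[ d ] q → q ≺[ d ] r → p ≺[ d ] r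
≼-≺-trans (inj₁ p≺q) q≺r = ≺-trans p≺q q≺r
≼-≺-trans (inj₂ p≋q) q≺r = ≋-≺-trans p≋q q≺r

≼⇒⊀ : p ≼[ d ] q → ¬ q ≺[ d ] p
≼⇒⊀ p≼q q≺p = ≺-irrefl (≼-≺-trans p≼q q≺p)

⊀⇒≼ : ∀ d (p q : Vec ℚ n) → ¬ q ≺[ d ] p → p ≼[ d ] q
⊀⇒≼ d p q q⊀p with ≺-compare d p q
... | inj₁ p≺q        = inj₁ p≺q
... | inj₂ (inj₁ p≋q) = inj₂ p≋q
... | inj₂ (inj₂ q≺p) = contradiction q≺p q⊀p

≋-truncate : d ≤ e → p ≋[ e ] q → p ≋[ d ] q
≋-truncate z≤n     _         = ≋-zero
≋-truncate (s≤s _)   ≋-[]      = ≋-[]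
≋-truncate (s≤s d≤e) (≋-∷ p≋q) = ≋-∷ (≋-truncate d≤e p≋q)

≺-truncate : d ≤ e → p ≺[ e ] q → p ≼[ d ] q
≺-truncate z≤n     _             = inj₂ ≋-zero
≺-truncate (s≤s _)   (≺-here a<b)  = inj₁ (≺-here a<b)
≺-truncate (s≤s d≤e) (≺-there p≺q) with ≺-truncate d≤e p≺q
... | inj₁ p≺q′ = inj₁ (≺-there p≺q′)
... | inj₂ p≋q  = inj₂ (≋-∷ p≋q)

≼-truncate : d ≤ e → p ≼[ e ] q → p ≼[ d ] q
≼-truncate d≤e (inj₁ p≺q) = ≺-truncate d≤e p≺q
≼-truncate d≤e (inj₂ p≋q) = inj₂ (≋-truncate d≤e p≋q)

≺-dense : p ≺[ d ] q → ∃ λ r → p ≺[ d ] r × r ≺[ d ] q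
≺-dense {p = a ∷ p} (≺-here a<b) with ℚP.<-dense a<b
... | c , a<c , c<b = c ∷ p , ≺-here a<c , ≺-here c<b
≺-dense {p = a ∷ _} (≺-there p≺q) with ≺-dense p≺q
... | r , p≺r , r≺q = a ∷ r , ≺-there p≺r , ≺-there r≺q

-- Lowering (raising) coordinate d moves a point down (up) at every depth e > d
-- without changing it at depth d.
≺-predecessor : d < e → e ≤ n → (z : Vec ℚ n) → ∃ λ y → y ≺[ e ] z × z ≋[ d ] y
≺-predecessor {zero}  (s≤s _)   (s≤s _)   (a ∷ z) = a ℚ.- 1ℚ ∷ z , ≺-here (x-1<x a) , ≋-zero
≺-predecessor {suc d} (s≤s d<e) (s≤s e≤n) (a ∷ z) with ≺-predecessor d<e e≤n z
... | y , y≺z , z≋y = a ∷ y , ≺-there y≺z , ≋-∷ z≋y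

≺-successor : d < e → e ≤ n → (z : Vec ℚ n) → ∃ λ y → z ≺[ e ] y × y ≋[ d ] z
≺-successor {zero}  (s≤s _)   (s≤s _)   (a ∷ z) = a ℚ.+ 1ℚ ∷ z , ≺-here (x<x+1 a) , ≋-zero
≺-successor {suc d} (s≤s d<e) (s≤s e≤n) (a ∷ z) with ≺-successor d<e e≤n z
... | y , z≺y , y≋z = a ∷ y , ≺-there z≺y , ≋-∷ y≋z

≺⇒L : p ≺[ d ] q → ∃ λ (j : Fin n) → toℕ j < d × L j p q
≺⇒L (≺-here a<b) = fzero , z<s , (λ _ ()) , a<b
≺⇒L {p = a ∷ p} {q = _ ∷ q} (≺-there p≺q) with ≺⇒L p≺q
... | j , j<d , agree , lt = fsuc j , s<s j<d , agree′ , lt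
  where
  agree′ : ∀ k → toℕ k < suc (toℕ j) → lookup (a ∷ p) k ≡ lookup (a ∷ q) k
  agree′ fzero    _         = refl
  agree′ (fsuc k) (s<s k<j) = agree k k<j

L⇒≺ : (j : Fin n) → toℕ j < d → L j p q → p ≺[ d ] q
L⇒≺ {p = _ ∷ _} {q = _ ∷ _} fzero    (s<s _)   (_ , a<b) = ≺-here a<b
L⇒≺ {p = _ ∷ _} {q = _ ∷ _} (fsuc j) (s<s j<d) (agree , lt) with agree fzero z<s
... | refl = ≺-there (L⇒≺ j j<d ((λ k k<j → agree (fsuc k) (s<s k<j)) , lt))

infix 4 _⊆_

_⊆_ : Relₓ n → Relₓ n → Set
A ⊆ B = ∀ x y → A x y → B x y

private variable
  A B C A′ B′ C′ J K W : Relₓ n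

⊆-refl : A ⊆ A
⊆-refl _ _ Axy = Axy

⊆-trans : A ⊆ B → B ⊆ C → A ⊆ C
⊆-trans A⊆B B⊆C x y = B⊆C x y ∘ A⊆B x y

∘-mono : A ⊆ A′ → B ⊆ B′ → (A ∘ᵣ B) ⊆ (A′ ∘ᵣ B′)
∘-mono A⊆A′ B⊆B′ x z (y , Axy , Byz) = y , A⊆A′ x y Axy , B⊆B′ y z Byz

∘-resp-≐ : A ≐ A′ → B ≐ B′ → C ≐ C′ → (A′ ∘ᵣ B′) ≐ C′ → (A ∘ᵣ B) ≐ C
∘-resp-≐ (A⊆A′ , A′⊆A) (B⊆B′ , B′⊆B) (C⊆C′ , C′⊆C) (A′B′⊆C′ , C′⊆A′B′) =
  ⊆-trans (∘-mono A⊆A′ B⊆B′) (⊆-trans A′B′⊆C′ C′⊆C) ,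
  ⊆-trans C⊆C′ (⊆-trans C′⊆A′B′ (∘-mono A′⊆A B′⊆B))

closedʳ-resp-≐ : A ≐ B → (B ∘ᵣ W) ⊆ B → (A ∘ᵣ W) ⊆ A
closedʳ-resp-≐ (A⊆B , B⊆A) BW⊆B = ⊆-trans (∘-mono A⊆B ⊆-refl) (⊆-trans BW⊆B B⊆A)

closedˡ-resp-≐ : A ≐ B → (W ∘ᵣ B) ⊆ B → (W ∘ᵣ A) ⊆ A
closedˡ-resp-≐ (A⊆B , B⊆A) WB⊆B = ⊆-trans (∘-mono ⊆-refl A⊆B) (⊆-trans WB⊆B B⊆A)

∘-absorbʳ : (K ∘ᵣ W) ⊆ K → J ⊆ W → (∀ z → ∃ λ y → J y z × W z y) → (K ∘ᵣ J) ≐ K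
∘-absorbʳ KW⊆K J⊆W predecessor =
  (λ x z (y , Kxy , Jyz) → KW⊆K x z (y , Kxy , J⊆W y z Jyz)) ,
  (λ x z Kxz → let (y , Jyz , Wzy) = predecessor z in y , KW⊆K x y (z , Kxz , Wzy) , Jyz)

∘-absorbˡ : (W ∘ᵣ K) ⊆ K → J ⊆ W → (∀ x → ∃ λ y → J x y × W y x) → (J ∘ᵣ K) ≐ K
∘-absorbˡ WK⊆K J⊆W successor =
  (λ x z (y , Jxy , Kyz) → WK⊆K x z (y , J⊆W x y Jxy , Kyz)) ,
  (λ x z Kxz → let (y , Jxy , Wyx) = successor x in y , Jxy , WK⊆K y z (x , Wyx , Kxz))

Strict Weak : ℕ → Relₓ n
Strict d (p , _) (q , _) = p ≺[ d ] q
Weak   d (p , _) (q , _) = p ≼[ d ] q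

Weak-refl : ∀ x → Weak {n} d x x
Weak-refl (p , _) = inj₂ (≋-refl _ p)

Weak-trans : (Weak {n} d ∘ᵣ Weak d) ⊆ Weak d
Weak-trans _ _ (_ , x≼y , y≼z) = ≼-trans x≼y y≼z

Strict-Weak-trans : (Strict {n} d ∘ᵣ Weak d) ⊆ Strict d
Strict-Weak-trans _ _ (_ , x≺y , y≼z) = ≺-≼-trans x≺y y≼z

Weak-Strict-trans : (Weak {n} d ∘ᵣ Strict d) ⊆ Strict d
Weak-Strict-trans _ _ (_ , x≼y , y≺z) = ≼-≺-trans x≼y y≺z

Weak-truncate : d ≤ e → Weak {n} e ⊆ Weak d
Weak-truncate d≤e (p , _) (q , _) = ≼-truncate d≤e

Strict⊆Weak : d ≤ e → Strict {n} e ⊆ Weak d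
Strict⊆Weak d≤e (p , _) (q , _) = ≺-truncate d≤e

Weak-idem : (Weak {n} d ∘ᵣ Weak d) ≐ Weak d
Weak-idem = ∘-absorbʳ Weak-trans ⊆-refl (λ z → z , Weak-refl z , Weak-refl z)

Weak-Strict-absorb : (Weak {n} d ∘ᵣ Strict d) ≐ Strict d
Weak-Strict-absorb = ∘-absorbˡ Weak-Strict-trans ⊆-refl (λ x → x , Weak-refl x , Weak-refl x)

Strict-Weak-absorb : (Strict {n} d ∘ᵣ Weak d) ≐ Strict d
Strict-Weak-absorb = ∘-absorbʳ Strict-Weak-trans ⊆-refl (λ z → z , Weak-refl z , Weak-refl z)

Strict-idem : (Strict {n} d ∘ᵣ Strict d) ≐ Strict d
Strict-idem =
  (λ _ _ (_ , x≺y , y≺z) → ≺-trans x≺y y≺z) ,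
  (λ (p , s) _ p≺q → let (r , p≺r , r≺q) = ≺-dense p≺q in (r , s) , p≺r , r≺q)

<ₙ⇒≺ : {p q : Vec ℚ n} → p <ₙ q → p ≺[ n ] q
<ₙ⇒≺ (j , Ljpq) = L⇒≺ j (toℕ<n j) Ljpq

≺⇒<ₙ : {p q : Vec ℚ n} → p ≺[ n ] q → p <ₙ q
≺⇒<ₙ p≺q = let (j , _ , Ljpq) = ≺⇒L p≺q in j , Ljpq

≤ₓ-trans : (_≤ₓ_ {n} ∘ᵣ _≤ₓ_) ⊆ _≤ₓ_
≤ₓ-trans _       _       (_       , inj₁ refl , y≤z)      = y≤z
≤ₓ-trans _       _       (_       , inj₂ x<y  , inj₁ refl) = inj₂ x<y
≤ₓ-trans (p , _) (r , _) ((q , _) , inj₂ p<q  , inj₂ q<r)  =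
  inj₂ (≺⇒<ₙ (≺-trans (<ₙ⇒≺ {p = p} {q} p<q) (<ₙ⇒≺ {p = q} {r} q<r)))

≤ₓ-idem : (_≤ₓ_ {n} ∘ᵣ _≤ₓ_) ≐ _≤ₓ_
≤ₓ-idem = ∘-absorbʳ ≤ₓ-trans ⊆-refl (λ z → z , inj₁ refl , inj₁ refl)

≤ₓ⊆Weak : d ≤ n → _≤ₓ_ ⊆ Weak {n} d
≤ₓ⊆Weak d≤n x       _       (inj₁ refl) = Weak-refl x
≤ₓ⊆Weak d≤n (p , _) (q , _) (inj₂ p<q)  = ≺-truncate d≤n (<ₙ⇒≺ p<q)

R-strict : ∀ k → R n -[1+ k ] ≐ Strict (n ∸ k)
R-strict k =
  (λ (p , _) (q , _) (j , j<d , Ljpq) → L⇒≺ {p = p} {q = q} j j<d Ljpq) ,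
  (λ (p , _) (q , _) → ≺⇒L {p = p} {q = q})

-- Since α only flips the sign, which Weak ignores, R_{k+1} is the complement of the converse
-- of Strict, i.e. Weak by trichotomy.
R-weak : ∀ k → R n (+ suc k) ≐ Weak (n ∸ k)
R-weak {n} k = R⊆Weak , Weak⊆R
  where
  R⊆Weak : R n (+ suc k) ⊆ Weak (n ∸ k)
  R⊆Weak (p , b) _ ((q , s) , q⊀p , refl) = ⊀⇒≼ (n ∸ k) p q (q⊀p ∘ proj₂ (R-strict k) (q , s) (p , b))

  flip-involutive : ∀ s → s ≡ flipSign (flipSign s)
  flip-involutive neg = refl
  flip-involutive pos = refl

  Weak⊆R : Weak (n ∸ k) ⊆ R n (+ suc k)
  Weak⊆R (p , b) (q , s) p≼q =
    (q , flipSign s) , ≼⇒⊀ p≼q ∘ proj₁ (R-strict k) (q , flipSign s) (p , b) , cong (q ,_) (flip-involutive s)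

-- R_i with i ≠ 0 compares the first  level n i  coordinates.
level : ℕ → ℤ → ℕ
level n i = n ∸ pred ∣ i ∣

R-closedʳ : ∀ i → 0 < ∣ i ∣ → (R n i ∘ᵣ Weak (level n i)) ⊆ R n i
R-closedʳ (+ suc k)  _ = closedʳ-resp-≐ (R-weak k) Weak-trans
R-closedʳ -[1+ k ]   _ = closedʳ-resp-≐ (R-strict k) Strict-Weak-trans

R-closedˡ : ∀ i → 0 < ∣ i ∣ → (Weak (level n i) ∘ᵣ R n i) ⊆ R n i
R-closedˡ (+ suc k)  _ = closedˡ-resp-≐ (R-weak k) Weak-trans
R-closedˡ -[1+ k ]   _ = closedˡ-resp-≐ (R-strict k) Weak-Strict-trans

R⊆Weak : ∀ j → ∣ j ∣ ≤ k → R n j ⊆ Weak (n ∸ k)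
R⊆Weak {k} {n} (+ zero)   _     = ≤ₓ⊆Weak (ℕP.m∸n≤m n k)
R⊆Weak {k} {n} (+ suc k′) k′<k  =
  ⊆-trans (proj₁ (R-weak k′)) (Weak-truncate (ℕP.∸-monoʳ-≤ n (ℕP.<⇒≤ k′<k)))
R⊆Weak {k} {n} -[1+ k′ ]  k′<k  =
  ⊆-trans (proj₁ (R-strict k′)) (Strict⊆Weak (ℕP.∸-monoʳ-≤ n (ℕP.<⇒≤ k′<k)))

R-predecessor : ∀ j → ∣ j ∣ ≤ k → k ≤ n → ∀ z → ∃ λ y → R n j y z × Weak (n ∸ k) z y
R-predecessor (+ zero)   _    _   z       = z , inj₁ refl , Weak-refl z
R-predecessor (+ suc k′) _    _   z       = z , proj₂ (R-weak k′) z z (Weak-refl z) , Weak-refl z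
R-predecessor {n = n} -[1+ k′ ] k′<k k≤n (p , s) =
  let (y , y≺p , p≋y) = ≺-predecessor (ℕP.∸-monoʳ-< k′<k k≤n) (ℕP.m∸n≤m n k′) p
  in (y , s) , proj₂ (R-strict k′) (y , s) (p , s) y≺p , inj₂ p≋y

R-successor : ∀ j → ∣ j ∣ ≤ k → k ≤ n → ∀ x → ∃ λ y → R n j x y × Weak (n ∸ k) y x
R-successor (+ zero)   _    _   x       = x , inj₁ refl , Weak-refl x
R-successor (+ suc k′) _    _   x       = x , proj₂ (R-weak k′) x x (Weak-refl x) , Weak-refl x
R-successor {n = n} -[1+ k′ ] k′<k k≤n (p , s) =
  let (y , p≺y , y≋p) = ≺-successor (ℕP.∸-monoʳ-< k′<k k≤n) (ℕP.m∸n≤m n k′) p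
  in (y , s) , proj₂ (R-strict k′) (p , s) (y , s) p≺y , inj₂ y≋p

R-absorbʳ : ∀ n i j → ∣ i ∣ ≤ suc n → ∣ j ∣ < ∣ i ∣ → (R n i ∘ᵣ R n j) ≐ R n i
R-absorbʳ n i j i≤1+n j<i =
  ∘-absorbʳ (R-closedʳ i (ℕP.m<n⇒0<n j<i)) (R⊆Weak j j≤k) (R-predecessor j j≤k (ℕP.pred-mono-≤ i≤1+n))
  where j≤k = ℕP.<⇒≤pred j<i

R-absorbˡ : ∀ n i j → ∣ j ∣ ≤ suc n → ∣ i ∣ < ∣ j ∣ → (R n i ∘ᵣ R n j) ≐ R n j
R-absorbˡ n i j j≤1+n i<j =
  ∘-absorbˡ (R-closedˡ j (ℕP.m<n⇒0<n i<j)) (R⊆Weak i i≤k) (R-successor i i≤k (ℕP.pred-mono-≤ j≤1+n))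
  where i≤k = ℕP.<⇒≤pred i<j

R-∘-same-level : ∀ n i j → ∣ i ∣ ≡ ∣ j ∣ → (R n i ∘ᵣ R n j) ≐ R n (i ⊓ j)
R-∘-same-level n (+ zero)  (+ zero)    refl = ≤ₓ-idem
R-∘-same-level n (+ suc k) (+ suc .k)  refl rewrite ℕP.⊓-idem k =
  ∘-resp-≐ (R-weak k) (R-weak k) (R-weak k) Weak-idem
R-∘-same-level n (+ suc k) -[1+ .k ]   refl =
  ∘-resp-≐ (R-weak k) (R-strict k) (R-strict k) Weak-Strict-absorb
R-∘-same-level n -[1+ k ]  (+ suc .k)  refl =
  ∘-resp-≐ (R-strict k) (R-weak k) (R-strict k) Strict-Weak-absorb
R-∘-same-level n -[1+ k ]  -[1+ .k ]   refl rewrite ℕP.⊔-idem k =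
  ∘-resp-≐ (R-strict k) (R-strict k) (R-strict k) Strict-idem

proposition3p10 : (n : ℕ) → 1 ≤ n → (i j : ℤ) → ∣ i ∣ ≤ suc n → ∣ j ∣ ≤ suc n →
    ((∣ j ∣ < ∣ i ∣ → (R n i ∘ᵣ R n j) ≐ R n i)
    × (∣ i ∣ < ∣ j ∣ → (R n i ∘ᵣ R n j) ≐ R n j)
    × (∣ i ∣ ≡ ∣ j ∣ → (R n i ∘ᵣ R n j) ≐ R n (i ⊓ j)))
proposition3p10 n _ i j ∣i∣≤1+n ∣j∣≤1+n =
  R-absorbʳ n i j ∣i∣≤1+n , R-absorbˡ n i j ∣j∣≤1+n , R-∘-same-level n i j
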